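{- Let $m\ge 2$ and $D\subset\mathbb{N}_{>0}$ non-empty finite, with $D\neq\{1\}$ if $m=2$, and let $P_{m,D}(X,t)$ be the characteristic polynomial of type $0$. Then $$t\frac{\partial P_{m,D}}{\partial t}(1,t_{m,D}^{(c)})=\frac{\gamma_{m,D}}{m-1},\qquad \frac{\partial P_{m,D}}{\partial X}(1,t_{m,D}^{(c)})=0,\qquad \frac{\partial^2 P_{m,D}}{\partial X^2}(1,t_{m,D}^{(c)})=\frac{m}{6}\gamma_{m,D}.$$
   Context: For $k\ge1$, let $\mathcal{W}_{m,k}$ be the set of sequences $(n_1,\dots,n_{mk})\in\{ -1,m-1\}^{mk}$ with $\sum_i n_i=0$ and $n_1=-1$. For $w\in\mathcal{W}_{m,k}$ and each index $j\in\{2,\dots,mk\}$ with $n_j=-1$, let $x_j(w)=n_1+\dots+n_{j-1}$. The characteristic polynomial of type $0$ is the Laurent polynomial $$P_{m,D}(X,t)=\sum_{k\in D}t^k\sum_{w\in\mathcal{W}_{m,k}}\ \sum_{j\ge 2:\,n_j=-1}X^{x_j(w)}.$$ (Combinatorially, it counts cells of type $0$ — white elementary stars of degree $mk$, $k\in D$, all of whose split-edges have type $m$, with two distinct distinguished labelled vertices "in" and "out" — with $t$ marking $k$ and $X$ marking the label of the out vertex minus that of the in vertex.) $t_{m,D}^{(c)}$ is the smallest positive root of $\sum_{k\in D}[(m-1)k-1]\binom{mk-1}{k}t^k=1$ (equivalently of $P_{m,D}(1,t)=1$), and $\gamma_{m,D}=\sum_{k\in D}[(m-1)k][(m-1)k-1]\binom{mk-1}{k}[t_{m,D}^{(c)}]^k$.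 -}

module Defs where

open import Level using (Level)
open import Data.Bool using (Bool; true; false; if_then_else_; _∧_)
open import Data.Nat as ℕ using (ℕ; zero; suc; _∸_)
open import Data.Nat.Combinatorics using (_C_)
open import Data.Integer as ℤ using (ℤ; +_; -[1+_])
open import Data.List using (List; []; _∷_; concatMap; filterᵇ)
open import Relation.Nullary.Decidable using (⌊_⌋)
open import Algebra.Bundles using (CommutativeRing)

minus1 : ℤ
minus1 = -[1+ 0 ]

sumℤ : List ℤ → ℤ
sumℤ []      = + 0
sumℤ (x ∷ xs) = x ℤ.+ sumℤ xs

steps : ℕ → ℕ → List (List ℤ)
steps m zero    = [] ∷ []
steps m (suc n) = concatMap (λ s → (minus1 ∷ s) ∷ (+ (m ∸ 1) ∷ s) ∷ []) (steps m n)

isWord : List ℤ → Bool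
isWord []      = false
isWord (n ∷ r) = ⌊ n ℤ.≟ minus1 ⌋ ∧ ⌊ sumℤ (n ∷ r) ℤ.≟ + 0 ⌋

W : ℕ → ℕ → List (List ℤ)
W m k = filterᵇ isWord (steps m (m ℕ.* k))

-- For w = (n_1,…,n_N): the list of x_j(w) = n_1+…+n_{j-1}
-- over the indices j ≥ 2 with n_j = -1 (in increasing order of j).
outLabels : List ℤ → List ℤ
outLabels []       = []
outLabels (n₁ ∷ r) = go n₁ r
  where
    go : ℤ → List ℤ → List ℤ
    go s []      = []
    go s (n ∷ r) with ⌊ n ℤ.≟ minus1 ⌋
    ... | true  = s ∷ go (s ℤ.+ n) r
    ... | false = go (s ℤ.+ n) r

sumMap : {A : Set} → (A → ℤ) → List A → ℤ
sumMap f []       = + 0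
sumMap f (x ∷ xs) = f x ℤ.+ sumMap f xs

-- Coefficient of t^k in a derivative/evaluation of P_{m,D} at X = 1,
-- obtained by applying g to each monomial exponent x_j(w):
--   g x = 1        gives  [t^k] P(1,t)
--   g x = x        gives  [t^k] ∂P/∂X (1,t)       (d/dX X^x = x X^{x-1})
--   g x = x(x-1)   gives  [t^k] ∂²P/∂X² (1,t)
coeffP : (ℤ → ℤ) → ℕ → ℕ → ℤ
coeffP g m k = sumMap (λ w → sumMap g (outLabels w)) (W m k)

module _ {c ℓ : Level} (R : CommutativeRing c ℓ) where
  open CommutativeRing R

  natR : ℕ → Carrier
  natR zero    = 0#
  natR (suc n) = 1# + natR n

  intR : ℤ → Carrier
  intR (+ n)      = natR n
  intR -[1+ n ]   = - natR (suc n)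

  pow : Carrier → ℕ → Carrier
  pow x zero    = 1#
  pow x (suc n) = x * pow x n

  seriesD : List ℕ → (ℕ → Carrier) → Carrier → Carrier
  seriesD []      a t = 0#
  seriesD (k ∷ D) a t = a k * pow t k + seriesD D a t

  P1 : ℕ → List ℕ → Carrier → Carrier
  P1 m D = seriesD D (λ k → intR (coeffP (λ _ → + 1) m k))

  tPt : ℕ → List ℕ → Carrier → Carrier
  tPt m D = seriesD D (λ k → intR (+ k ℤ.* coeffP (λ _ → + 1) m k))

  PX : ℕ → List ℕ → Carrier → Carrier
  PX m D = seriesD D (λ k → intR (coeffP (λ x → x) m k))

  PXX : ℕ → List ℕ → Carrier → Carrier
  PXX m D = seriesD D (λ k → intR (coeffP (λ x → x ℤ.* (x ℤ.- + 1)) m k))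

  -- Σ_{k∈D} [(m-1)k-1] C(mk-1,k) t^k  (its smallest positive root solves this = 1)
  critPoly : ℕ → List ℕ → Carrier → Carrier
  critPoly m D = seriesD D (λ k → natR ((((m ∸ 1) ℕ.* k) ∸ 1) ℕ.* ((m ℕ.* k ∸ 1) C k)))

  gamma : ℕ → List ℕ → Carrier → Carrier
  gamma m D = seriesD D (λ k → natR (((m ∸ 1) ℕ.* k) ℕ.* (((m ∸ 1) ℕ.* k) ∸ 1) ℕ.* ((m ℕ.* k ∸ 1) C k)))

-- Every word of 𝒲_{m,k} is a first step -1 followed by a lattice path with a = (m-1)k - 1
-- down-steps -1 and b = k up-steps m-1 ending at height 1, and x_j(w) is -1 plus the height
-- of that path before the corresponding down-step. So the coefficients of t^k in P(1,t),
-- ∂P/∂X(1,t) and ∂²P/∂X²(1,t) are sums over such paths of a quadratic in these heights.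
-- Removing the first step of a path shifts all heights by -1 or by m-1, which turns a quadratic
-- into another quadratic; hence these sums obey a Pascal-type recursion in (a, b), solved in
-- closed form (labelMoment) with the absorption identity (a+1)·C(a+b+1, b) = (b+1)·C(a+b+1, b+1)
-- relating the two branches. At (m-1)b = a+1 the closed form gives the three identities
-- coefficientwise.

module Submission where

open import Defs
open import Level using (Level)
open import Data.Nat using (ℕ; _≤_; _≥_; _<_; _∸_)
open import Data.List using (List; []; _∷_)
open import Data.List.Relation.Unary.All using (All; []; _∷_)
open import Data.List.Relation.Unary.Unique.Propositional using (Unique)
open import Relation.Binary.PropositionalEquality using (_≡_; _≢_)
open import Data.Product using (_×_; _,_)
open import Algebra.Bundles using (CommutativeRing)

open import Data.Nat using (zero; suc; s≤s)
import Data.Nat as ℕ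
import Data.Nat.Properties as ℕ
import Data.Nat.Tactic.RingSolver as ℕ-Solver
open import Data.Nat.Combinatorics using (_C_; nCn≡1; nCk+nC[k+1]≡[n+1]C[k+1])
open import Data.Integer using (ℤ; +_; -[1+_])
import Data.Integer as Int
import Data.Integer.Properties as ℤ
open import Data.Bool using (Bool; true; false; if_then_else_)
open import Data.List using (map; concatMap; filterᵇ)
open import Function using (_∘_; mk⇔)
open import Relation.Nullary using (yes; no; contradiction)
open import Relation.Nullary.Decidable using (⌊_⌋; isYes≗does; does-⇔)

module _ where
  open import Data.Nat using (_+_; _*_)
  open import Relation.Binary.PropositionalEquality using (sym; trans; cong; module ≡-Reasoning)
  open ≡-Reasoning

  pathCount : ℕ → ℕ → ℕ
  pathCount a b = (a + b) C b

  pathCount-pascal : ∀ a b → pathCount (suc a) (suc b) ≡ pathCount a (suc b) + pathCount (suc a) b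
  pathCount-pascal a b = begin
    suc (a + suc b) C suc b                  ≡⟨ nCk+nC[k+1]≡[n+1]C[k+1] (a + suc b) b ⟨
    (a + suc b) C b + (a + suc b) C suc b    ≡⟨ ℕ.+-comm ((a + suc b) C b) _ ⟩
    (a + suc b) C suc b + (a + suc b) C b    ≡⟨ cong (λ n → pathCount a (suc b) + n C b) (ℕ.+-suc a b) ⟩
    pathCount a (suc b) + pathCount (suc a) b ∎

  pathCount-absorbʳ : ∀ a b → suc b * pathCount a (suc b) ≡ suc (a + b) * pathCount a b
  pathCount-absorbˡ : ∀ a b → suc a * pathCount (suc a) b ≡ suc (a + b) * pathCount a b
  pathCount-absorbʳ zero b = cong (suc b *_) (trans (nCn≡1 (suc b)) (sym (nCn≡1 b)))
  pathCount-absorbʳ (suc a) b = begin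
    suc b * pathCount (suc a) (suc b)
      ≡⟨ cong (suc b *_) (pathCount-pascal a b) ⟩
    suc b * (pathCount a (suc b) + pathCount (suc a) b)
      ≡⟨ ℕ.*-distribˡ-+ (suc b) (pathCount a (suc b)) (pathCount (suc a) b) ⟩
    suc b * pathCount a (suc b) + suc b * pathCount (suc a) b
      ≡⟨ cong (_+ suc b * pathCount (suc a) b)
              (trans (pathCount-absorbʳ a b) (sym (pathCount-absorbˡ a b))) ⟩
    suc a * pathCount (suc a) b + suc b * pathCount (suc a) b
      ≡⟨ ℕ.*-distribʳ-+ (pathCount (suc a) b) (suc a) (suc b) ⟨
    (suc a + suc b) * pathCount (suc a) b
      ≡⟨ cong (_* pathCount (suc a) b) (ℕ.+-suc (suc a) b) ⟩
    suc (suc a + b) * pathCount (suc a) b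
      ∎
  pathCount-absorbˡ a zero = cong (λ n → suc n * 1) (sym (ℕ.+-identityʳ a))
  pathCount-absorbˡ a (suc b) = begin
    suc a * pathCount (suc a) (suc b)
      ≡⟨ cong (suc a *_) (pathCount-pascal a b) ⟩
    suc a * (pathCount a (suc b) + pathCount (suc a) b)
      ≡⟨ ℕ.*-distribˡ-+ (suc a) (pathCount a (suc b)) (pathCount (suc a) b) ⟩
    suc a * pathCount a (suc b) + suc a * pathCount (suc a) b
      ≡⟨ cong (λ x → suc a * pathCount a (suc b) + x)
              (trans (pathCount-absorbˡ a b) (sym (pathCount-absorbʳ a b))) ⟩
    suc a * pathCount a (suc b) + suc b * pathCount a (suc b)
      ≡⟨ ℕ.*-distribʳ-+ (pathCount a (suc b)) (suc a) (suc b) ⟨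
    (suc a + suc b) * pathCount a (suc b)
      ∎

  pathCount-absorb : ∀ a b → suc a * pathCount (suc a) b ≡ suc b * pathCount a (suc b)
  pathCount-absorb a b = trans (pathCount-absorbˡ a b) (sym (pathCount-absorbʳ a b))

module _ where
  open import Relation.Binary.PropositionalEquality
    using (refl; sym; trans; cong; cong₂; module ≡-Reasoning)
  open import Data.Integer using (_+_; _*_; _-_; -_; _≟_)
  open import Data.Integer.Tactic.RingSolver using (solve-∀)
  open ≡-Reasoning

  sumMap-cong : {A : Set} {f g : A → ℤ} → (∀ x → f x ≡ g x) → (xs : List A) →
                sumMap f xs ≡ sumMap g xs
  sumMap-cong f≗g []       = refl
  sumMap-cong f≗g (x ∷ xs) = cong₂ _+_ (f≗g x) (sumMap-cong f≗g xs)

  sumMap-map : {A B : Set} (f : B → ℤ) (h : A → B) (xs : List A) →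
               sumMap f (map h xs) ≡ sumMap (f ∘ h) xs
  sumMap-map f h []       = refl
  sumMap-map f h (x ∷ xs) = cong (λ s → f (h x) + s) (sumMap-map f h xs)

  sumMap-filterᵇ : {A : Set} (f : A → ℤ) (p : A → Bool) (xs : List A) →
                   sumMap f (filterᵇ p xs) ≡ sumMap (λ x → if p x then f x else + 0) xs
  sumMap-filterᵇ f p []       = refl
  sumMap-filterᵇ f p (x ∷ xs) with p x
  ... | true  = cong (λ s → f x + s) (sumMap-filterᵇ f p xs)
  ... | false = trans (sumMap-filterᵇ f p xs) (sym (ℤ.+-identityˡ _))

  sumMap-concatMap-pair : {A B : Set} (f : B → ℤ) (g h : A → B) (xs : List A) →
    sumMap f (concatMap (λ x → g x ∷ h x ∷ []) xs) ≡ sumMap (f ∘ g) xs + sumMap (f ∘ h) xs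
  sumMap-concatMap-pair f g h []       = refl
  sumMap-concatMap-pair f g h (x ∷ xs) =
    trans (cong (λ s → f (g x) + (f (h x) + s)) (sumMap-concatMap-pair f g h xs))
          (interchange (f (g x)) (f (h x)) _ _)
    where
    interchange : ∀ a b c d → a + (b + (c + d)) ≡ (a + c) + (b + d)
    interchange = solve-∀

  ⌊≟⌋-shift : ∀ x y r → ⌊ x + y ≟ r ⌋ ≡ ⌊ y ≟ r - x ⌋
  ⌊≟⌋-shift x y r = begin
    ⌊ x + y ≟ r ⌋     ≡⟨ isYes≗does (x + y ≟ r) ⟩
    _                 ≡⟨ does-⇔ (mk⇔ to from) (x + y ≟ r) (y ≟ r - x) ⟩
    _                 ≡⟨ isYes≗does (y ≟ r - x) ⟨
    ⌊ y ≟ r - x ⌋     ∎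
    where
    cancel : ∀ x y → y ≡ x + y - x
    cancel = solve-∀
    uncancel : ∀ x r → x + (r - x) ≡ r
    uncancel = solve-∀
    to : x + y ≡ r → y ≡ r - x
    to refl = cancel x y
    from : y ≡ r - x → x + y ≡ r
    from refl = uncancel x r

  -- outLabels uses the first entry only as the starting height, so these are the heights
  -- of w just before each of its down-steps.
  labels : List ℤ → List ℤ
  labels w = outLabels (+ 0 ∷ w)

  outLabels-+ : ∀ s t w → outLabels (s + t ∷ w) ≡ map (λ x → s + x) (outLabels (t ∷ w))
  outLabels-+ s t []      = refl
  outLabels-+ s t (n ∷ w) with ⌊ n ≟ minus1 ⌋
  ... | true  = cong (s + t ∷_) shifted
    where shifted = trans (cong (λ z → outLabels (z ∷ w)) (ℤ.+-assoc s t n)) (outLabels-+ s (t + n) w)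
  ... | false = trans (cong (λ z → outLabels (z ∷ w)) (ℤ.+-assoc s t n)) (outLabels-+ s (t + n) w)

  outLabels≡map-labels : ∀ s w → outLabels (s ∷ w) ≡ map (λ x → s + x) (labels w)
  outLabels≡map-labels s w =
    trans (cong (λ z → outLabels (z ∷ w)) (sym (ℤ.+-identityʳ s))) (outLabels-+ s (+ 0) w)

  quad : ℤ → ℤ → ℤ → ℤ → ℤ
  quad α β γ x = α + β * x + γ * (x * x)

  sumMap-quad-shift : ∀ α β γ c xs →
    sumMap (quad α β γ) (map (λ x → c + x) xs)
      ≡ sumMap (quad (quad α β γ c) (β + + 2 * γ * c) γ) xs
  sumMap-quad-shift α β γ c xs =
    trans (sumMap-map (quad α β γ) (λ x → c + x) xs) (sumMap-cong (taylor α β γ c) xs)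
    where
    taylor : ∀ α β γ c x →
      α + β * (c + x) + γ * ((c + x) * (c + x))
        ≡ (α + β * c + γ * (c * c)) + (β + + 2 * γ * c) * x + γ * (x * x)
    taylor = solve-∀

  weight : ℤ → ℤ → ℤ → ℤ → List ℤ → ℤ
  weight δ α β γ w = δ + sumMap (quad α β γ) (labels w)

  weight-down : ∀ δ α β γ w →
    weight δ α β γ (minus1 ∷ w) ≡ weight (δ + α) (quad α β γ minus1) (β + + 2 * γ * minus1) γ w
  weight-down δ α β γ w = begin
    δ + (quad α β γ (+ 0) + sumMap (quad α β γ) (outLabels (minus1 ∷ w)))
      ≡⟨ cong (λ L → δ + (quad α β γ (+ 0) + sumMap (quad α β γ) L))
              (outLabels≡map-labels minus1 w) ⟩
    δ + (quad α β γ (+ 0) + sumMap (quad α β γ) (map (λ x → minus1 + x) (labels w)))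
      ≡⟨ cong (λ s → δ + (quad α β γ (+ 0) + s))
              (sumMap-quad-shift α β γ minus1 (labels w)) ⟩
    δ + (quad α β γ (+ 0) + sumMap _ (labels w))
      ≡⟨ reassoc δ α β γ _ ⟩
    (δ + α) + sumMap _ (labels w)
      ∎
    where
    reassoc : ∀ δ α β γ s → δ + ((α + β * + 0 + γ * (+ 0 * + 0)) + s) ≡ (δ + α) + s
    reassoc = solve-∀

  weight-up : ∀ u δ α β γ w →
    weight δ α β γ (+ u ∷ w) ≡ weight δ (quad α β γ (+ u)) (β + + 2 * γ * + u) γ w
  weight-up u δ α β γ w = cong (λ s → δ + s) (begin
    sumMap (quad α β γ) (outLabels (+ u ∷ w))
      ≡⟨ cong (sumMap (quad α β γ)) (outLabels≡map-labels (+ u) w) ⟩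
    sumMap (quad α β γ) (map (λ x → + u + x) (labels w))
      ≡⟨ sumMap-quad-shift α β γ (+ u) (labels w) ⟩
    sumMap (quad (quad α β γ (+ u)) (β + + 2 * γ * + u) γ) (labels w)
      ∎)

  paths : ℕ → ℕ → ℤ → List (List ℤ)
  paths u n r = filterᵇ (λ s → ⌊ sumℤ s ≟ r ⌋) (steps (suc u) n)

  sumMap-paths-suc : ∀ u n r (f : List ℤ → ℤ) →
    sumMap f (paths u (suc n) r)
      ≡ sumMap (f ∘ (minus1 ∷_)) (paths u n (r - minus1))
      + sumMap (f ∘ (+ u ∷_)) (paths u n (r - + u))
  sumMap-paths-suc u n r f = begin
    sumMap f (paths u (suc n) r)
      ≡⟨ sumMap-filterᵇ f _ (steps (suc u) (suc n)) ⟩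
    sumMap (λ s → if ⌊ sumℤ s ≟ r ⌋ then f s else + 0) (steps (suc u) (suc n))
      ≡⟨ sumMap-concatMap-pair _ (minus1 ∷_) (+ u ∷_) (steps (suc u) n) ⟩
    sumMap (first-step minus1) (steps (suc u) n) + sumMap (first-step (+ u)) (steps (suc u) n)
      ≡⟨ cong₂ _+_ (sumMap-cong (first-step≡ minus1) (steps (suc u) n))
                   (sumMap-cong (first-step≡ (+ u)) (steps (suc u) n)) ⟩
    sumMap (rest-step minus1) (steps (suc u) n) + sumMap (rest-step (+ u)) (steps (suc u) n)
      ≡⟨ cong₂ _+_ (sumMap-filterᵇ _ _ (steps (suc u) n)) (sumMap-filterᵇ _ _ (steps (suc u) n)) ⟨
    sumMap (f ∘ (minus1 ∷_)) (paths u n (r - minus1))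
      + sumMap (f ∘ (+ u ∷_)) (paths u n (r - + u))
      ∎
    where
    first-step rest-step : ℤ → List ℤ → ℤ
    first-step x s = if ⌊ x + sumℤ s ≟ r ⌋ then f (x ∷ s) else + 0
    rest-step  x s = if ⌊ sumℤ s ≟ r - x ⌋ then f (x ∷ s) else + 0
    first-step≡ : ∀ x s → first-step x s ≡ rest-step x s
    first-step≡ x s = cong (λ b → if b then f (x ∷ s) else + 0) (⌊≟⌋-shift x (sumℤ s) r)

  paths-above : ∀ u n j {r} (f : List ℤ → ℤ) →
    r ≡ + u * + n + + suc j → sumMap f (paths u n r) ≡ + 0
  paths-above u zero j {r} f r≡ with + 0 ≟ r
  ... | yes 0≡r = contradiction (trans 0≡r (trans r≡ (cong (_+ + suc j) (ℤ.*-zeroʳ (+ u))))) λ ()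
  ... | no _    = refl
  paths-above u (suc n) j f refl = begin
    sumMap f (paths u (suc n) _)
      ≡⟨ sumMap-paths-suc u n _ f ⟩
    sumMap _ (paths u n _) + sumMap _ (paths u n _)
      ≡⟨ cong₂ _+_ (paths-above u n (u ℕ.+ suc j) _ (down (+ u) (+ n) (+ j)))
                   (paths-above u n j _ (up (+ u) (+ n) (+ j))) ⟩
    + 0
      ∎
    where
    down : ∀ U N J → U * (+ 1 + N) + (+ 1 + J) - minus1 ≡ U * N + (+ 1 + (U + (+ 1 + J)))
    down = solve-∀
    up : ∀ U N J → U * (+ 1 + N) + (+ 1 + J) - U ≡ U * N + (+ 1 + J)
    up = solve-∀

  paths-below : ∀ u n j {r} (f : List ℤ → ℤ) →
    r ≡ - + n - + suc j → sumMap f (paths u n r) ≡ + 0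
  paths-below u zero j f refl = refl
  paths-below u (suc n) j f refl = begin
    sumMap f (paths u (suc n) _)
      ≡⟨ sumMap-paths-suc u n _ f ⟩
    sumMap _ (paths u n _) + sumMap _ (paths u n _)
      ≡⟨ cong₂ _+_ (paths-below u n j _ (down (+ n) (+ j)))
                   (paths-below u n (suc j ℕ.+ u) _ (up (+ u) (+ n) (+ j))) ⟩
    + 0
      ∎
    where
    down : ∀ N J → - (+ 1 + N) - (+ 1 + J) - minus1 ≡ - N - (+ 1 + J)
    down = solve-∀
    up : ∀ U N J → - (+ 1 + N) - (+ 1 + J) - U ≡ - N - (+ 1 + ((+ 1 + J) + U))
    up = solve-∀

  sumMap-weight-paths-suc : ∀ u n r δ α β γ →
    sumMap (weight δ α β γ) (paths u (suc n) r)
      ≡ sumMap (weight (δ + α) (quad α β γ minus1) (β + + 2 * γ * minus1) γ)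
               (paths u n (r - minus1))
      + sumMap (weight δ (quad α β γ (+ u)) (β + + 2 * γ * + u) γ)
               (paths u n (r - + u))
  sumMap-weight-paths-suc u n r δ α β γ =
    trans (sumMap-paths-suc u n r (weight δ α β γ))
          (cong₂ _+_ (sumMap-cong (weight-down δ α β γ) (paths u n (r - minus1)))
                     (sumMap-cong (weight-up u δ α β γ) (paths u n (r - + u))))

  -- Six times the mean, over the arrangements of A down-steps and B up-steps of height U,
  -- of the sum of α + β x + γ x² over the labels x of a path.
  labelMoment : ℤ → ℤ → ℤ → ℤ → ℤ → ℤ → ℤ
  labelMoment U A B α β γ =
    let X = U * B - A + + 1 in A * (+ 6 * α + + 3 * β * X + γ * (A - + 1 + B * U * U + + 2 * X * X))

  drop-residual : ∀ {e t} l {x y} → e ≡ t + l * (x - y) → x ≡ y → e ≡ t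
  drop-residual {t = t} l {x = x} e≡ refl = trans e≡ (vanish t l x)
    where
    vanish : ∀ t l x → t + l * (x - x) ≡ t
    vanish = solve-∀

  labelMoment-recursion : ∀ U A B δ α β γ K₁ K₂ Φ₁ Φ₂ →
    + 6 * Φ₁ ≡ K₁ * (+ 6 * (δ + α)
                     + labelMoment U A (+ 1 + B) (quad α β γ minus1) (β + + 2 * γ * minus1) γ) →
    + 6 * Φ₂ ≡ K₂ * (+ 6 * δ + labelMoment U (+ 1 + A) B (quad α β γ U) (β + + 2 * γ * U) γ) →
    (+ 1 + A) * K₂ ≡ (+ 1 + B) * K₁ →
    + 6 * (Φ₁ + Φ₂) ≡ (K₁ + K₂) * (+ 6 * δ + labelMoment U (+ 1 + A) (+ 1 + B) α β γ)
  labelMoment-recursion U A B δ α β γ K₁ K₂ Φ₁ Φ₂ h₁ h₂ absorb = begin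
    + 6 * (Φ₁ + Φ₂)      ≡⟨ ℤ.*-distribˡ-+ (+ 6) Φ₁ Φ₂ ⟩
    + 6 * Φ₁ + + 6 * Φ₂  ≡⟨ cong₂ _+_ h₁ h₂ ⟩
    _                    ≡⟨ drop-residual (+ 3 * β * U + γ * (U * U + + 2 * U * (U * (+ 1 + B) - A)))
                                          (identity U A B δ α β γ K₁ K₂) absorb ⟩
    (K₁ + K₂) * (+ 6 * δ + labelMoment U (+ 1 + A) (+ 1 + B) α β γ) ∎
    where
    identity : ∀ U A B δ α β γ K₁ K₂ →
      let q  = λ α β γ x → α + β * x + γ * (x * x)
          lm = λ U A B α β γ → let X = U * B - A + + 1 in
                 A * (+ 6 * α + + 3 * β * X + γ * (A - + 1 + B * U * U + + 2 * X * X))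
      in K₁ * (+ 6 * (δ + α) + lm U A (+ 1 + B) (q α β γ minus1) (β + + 2 * γ * minus1) γ)
         + K₂ * (+ 6 * δ + lm U (+ 1 + A) B (q α β γ U) (β + + 2 * γ * U) γ)
         ≡ (K₁ + K₂) * (+ 6 * δ + lm U (+ 1 + A) (+ 1 + B) α β γ)
         + (+ 3 * β * U + γ * (U * U + + 2 * U * (U * (+ 1 + B) - A)))
           * ((+ 1 + A) * K₂ - (+ 1 + B) * K₁)
    identity = solve-∀

  sumMap-paths-zero : ∀ u {r} (f : List ℤ → ℤ) →
    r ≡ + 0 → sumMap f (paths u 0 r) ≡ f [] + + 0
  sumMap-paths-zero u {r} f r≡0 with + 0 ≟ r
  ... | yes _   = refl
  ... | no 0≢r  = contradiction (sym r≡0) 0≢r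

  sumMap-weight-paths : ∀ u δ α β γ a b {n r} → n ≡ a ℕ.+ b → r ≡ + u * + b - + a →
    + 6 * sumMap (weight δ α β γ) (paths u n r)
      ≡ + pathCount a b * (+ 6 * δ + labelMoment (+ u) (+ a) (+ b) α β γ)
  sumMap-weight-paths u δ α β γ zero zero refl r≡ =
    trans (cong (+ 6 *_) (sumMap-paths-zero u (weight δ α β γ) (trans r≡ (origin (+ u)))))
          (unit δ)
    where
    origin : ∀ U → U * + 0 - + 0 ≡ + 0
    origin = solve-∀
    unit : ∀ δ → + 6 * ((δ + + 0) + + 0) ≡ + 1 * (+ 6 * δ + + 0)
    unit = solve-∀
  -- An empty branch enters labelMoment-recursion as the count 0 at B = -1, resp. A = -1.
  sumMap-weight-paths u δ α β γ (suc a) zero {r = r} refl refl =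
    trans (cong (+ 6 *_) (trans (sumMap-weight-paths-suc u (a ℕ.+ 0) r δ α β γ)
                                (cong (λ z → Φ + z) (paths-below u (a ℕ.+ 0) u _ below))))
          (labelMoment-recursion (+ u) (+ a) -[1+ 0 ] δ α β γ (+ 1) (+ 0) Φ (+ 0)
            (sumMap-weight-paths u (δ + α) (quad α β γ minus1) (β + + 2 * γ * minus1) γ a zero
              refl (down (+ u) (+ a)))
            refl (ℤ.*-zeroʳ (+ suc a)))
    where
    down : ∀ U A → U * + 0 - (+ 1 + A) - minus1 ≡ U * + 0 - A
    down = solve-∀
    up : ∀ U A → U * + 0 - (+ 1 + A) - U ≡ - A - (+ 1 + U)
    up = solve-∀
    Φ = sumMap (weight (δ + α) (quad α β γ minus1) (β + + 2 * γ * minus1) γ)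
               (paths u (a ℕ.+ 0) (r - minus1))
    below : r - + u ≡ - + (a ℕ.+ 0) - + suc u
    below = trans (up (+ u) (+ a)) (cong (λ n → - + n - + suc u) (sym (ℕ.+-identityʳ a)))
  sumMap-weight-paths u δ α β γ zero (suc b) {r = r} refl refl =
    trans (cong (+ 6 *_) (trans (sumMap-weight-paths-suc u b r δ α β γ)
                                (cong (λ z → z + Φ) (paths-above u b u _ (above (+ u) (+ b))))))
    (trans (labelMoment-recursion (+ u) -[1+ 0 ] (+ b) δ α β γ (+ 0) (+ pathCount 0 b) (+ 0) Φ
             refl
             (sumMap-weight-paths u δ (quad α β γ (+ u)) (β + + 2 * γ * + u) γ zero b
                refl (up (+ u) (+ b)))
             (sym (ℤ.*-zeroʳ (+ suc b))))
           (cong (λ k → + k * (+ 6 * δ + + 0)) (trans (nCn≡1 b) (sym (nCn≡1 (suc b))))))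
    where
    above : ∀ U B → U * (+ 1 + B) - + 0 - minus1 ≡ U * B + (+ 1 + U)
    above = solve-∀
    up : ∀ U B → U * (+ 1 + B) - + 0 - U ≡ U * B - + 0
    up = solve-∀
    Φ = sumMap (weight δ (quad α β γ (+ u)) (β + + 2 * γ * + u) γ) (paths u b (r - + u))
  sumMap-weight-paths u δ α β γ (suc a) (suc b) {r = r} refl refl =
    trans (cong (+ 6 *_) (sumMap-weight-paths-suc u (a ℕ.+ suc b) r δ α β γ))
    (trans (labelMoment-recursion (+ u) (+ a) (+ b) δ α β γ
             (+ pathCount a (suc b)) (+ pathCount (suc a) b) _ _
             (sumMap-weight-paths u (δ + α) (quad α β γ minus1) (β + + 2 * γ * minus1) γ a (suc b)
                refl (down (+ u) (+ b) (+ a)))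
             (sumMap-weight-paths u δ (quad α β γ (+ u)) (β + + 2 * γ * + u) γ (suc a) b
                (ℕ.+-suc a b) (up (+ u) (+ b) (+ a)))
             absorb)
           (cong (λ k → + k * (+ 6 * δ + labelMoment (+ u) (+ suc a) (+ suc b) α β γ))
                 (sym (pathCount-pascal a b))))
    where
    down : ∀ U B A → U * (+ 1 + B) - (+ 1 + A) - minus1 ≡ U * (+ 1 + B) - A
    down = solve-∀
    up : ∀ U B A → U * (+ 1 + B) - (+ 1 + A) - U ≡ U * B - (+ 1 + A)
    up = solve-∀
    absorb : + suc a * + pathCount (suc a) b ≡ + suc b * + pathCount a (suc b)
    absorb = begin
      + suc a * + pathCount (suc a) b   ≡⟨ ℤ.pos-* (suc a) _ ⟨
      + (suc a ℕ.* pathCount (suc a) b) ≡⟨ cong +_ (pathCount-absorb a b) ⟩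
      + (suc b ℕ.* pathCount a (suc b)) ≡⟨ ℤ.pos-* (suc b) _ ⟩
      + suc b * + pathCount a (suc b)   ∎

  sumMap-zero : {A : Set} (xs : List A) → sumMap (λ _ → + 0) xs ≡ + 0
  sumMap-zero []       = refl
  sumMap-zero (x ∷ xs) = trans (ℤ.+-identityˡ _) (sumMap-zero xs)

  sumMap-words : ∀ u n (f : List ℤ → ℤ) →
    sumMap f (filterᵇ isWord (steps (suc u) (suc n)))
      ≡ sumMap (f ∘ (minus1 ∷_)) (paths u n (+ 1))
  sumMap-words u n f = begin
    sumMap f (filterᵇ isWord (steps (suc u) (suc n)))
      ≡⟨ sumMap-filterᵇ f isWord (steps (suc u) (suc n)) ⟩
    sumMap (λ s → if isWord s then f s else + 0) (steps (suc u) (suc n))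
      ≡⟨ sumMap-concatMap-pair _ (minus1 ∷_) (+ u ∷_) (steps (suc u) n) ⟩
    sumMap first-down (steps (suc u) n) + sumMap (λ _ → + 0) (steps (suc u) n)
      ≡⟨ cong₂ _+_ (sumMap-cong first-down≡ (steps (suc u) n))
                   (sumMap-zero (steps (suc u) n)) ⟩
    sumMap (λ s → if ⌊ sumℤ s ≟ + 1 ⌋ then f (minus1 ∷ s) else + 0) (steps (suc u) n) + + 0
      ≡⟨ ℤ.+-identityʳ _ ⟩
    sumMap (λ s → if ⌊ sumℤ s ≟ + 1 ⌋ then f (minus1 ∷ s) else + 0) (steps (suc u) n)
      ≡⟨ sumMap-filterᵇ (f ∘ (minus1 ∷_)) _ (steps (suc u) n) ⟨
    sumMap (f ∘ (minus1 ∷_)) (paths u n (+ 1))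
      ∎
    where
    first-down : List ℤ → ℤ
    first-down s = if ⌊ minus1 + sumℤ s ≟ + 0 ⌋ then f (minus1 ∷ s) else + 0
    first-down≡ : ∀ s → first-down s ≡ (if ⌊ sumℤ s ≟ + 1 ⌋ then f (minus1 ∷ s) else + 0)
    first-down≡ s =
      cong (λ b → if b then f (minus1 ∷ s) else + 0) (⌊≟⌋-shift minus1 (sumℤ s) (+ 0))

  labelMoment-critical : ∀ U A B α β γ → U * B ≡ + 1 + A →
    labelMoment U A B α β γ ≡ A * (+ 6 * α + + 6 * β + γ * (A + + 7 + (+ 1 + A) * U))
  labelMoment-critical U A B α β γ =
    drop-residual (A * (+ 3 * β + γ * (U + + 8 + + 2 * (U * B - (+ 1 + A))))) (identity U A B α β γ)
    where
    identity : ∀ U A B α β γ →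
      let X = U * B - A + + 1 in
      A * (+ 6 * α + + 3 * β * X + γ * (A - + 1 + B * U * U + + 2 * X * X))
        ≡ A * (+ 6 * α + + 6 * β + γ * (A + + 7 + (+ 1 + A) * U))
        + A * (+ 3 * β + γ * (U + + 8 + + 2 * (U * B - (+ 1 + A)))) * (U * B - (+ 1 + A))
    identity = solve-∀

  gammaCoeff : ℕ → ℕ → ℕ
  gammaCoeff m k = ((m ∸ 1) ℕ.* k) ℕ.* (((m ∸ 1) ℕ.* k) ∸ 1) ℕ.* ((m ℕ.* k ∸ 1) C k)

  pos-*³ : ∀ x y z → + (x ℕ.* y ℕ.* z) ≡ + x * + y * + z
  pos-*³ x y z = trans (ℤ.pos-* (x ℕ.* y) z) (cong (_* + z) (ℤ.pos-* x y))

  -- a = (m - 1) k - 1 counts the down-steps after the first one.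
  module _ (u' k' : ℕ) where
    private
      m k a n : ℕ
      m = 2 ℕ.+ u'
      k = suc k'
      a = k' ℕ.+ u' ℕ.* suc k'
      n = m ℕ.* k ∸ 1
      U A B K : ℤ
      U = + suc u'
      A = + a
      B = + k
      K = + (n C k)
      UB≡1+A : U * B ≡ + 1 + A
      UB≡1+A = sym (ℤ.pos-* (suc u') k)
      n≡a+k : n ≡ a ℕ.+ k
      n≡a+k = solve k' (u' ℕ.* suc k')
        where
        solve : ∀ k x → k ℕ.+ (suc k ℕ.+ x) ≡ k ℕ.+ x ℕ.+ suc k
        solve = ℕ-Solver.solve-∀

    coeffP-quad : ∀ g α β γ → (∀ x → g (minus1 + x) ≡ quad α β γ x) →
      + 6 * coeffP g m k ≡ K * (A * (+ 6 * α + + 6 * β + γ * (A + + 7 + (+ 1 + A) * U)))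
    coeffP-quad g α β γ g≗q = begin
      + 6 * coeffP g m k
        ≡⟨ cong (+ 6 *_) (sumMap-words (suc u') n (sumMap g ∘ outLabels)) ⟩
      + 6 * sumMap (λ w → sumMap g (outLabels (minus1 ∷ w))) (paths (suc u') n (+ 1))
        ≡⟨ cong (+ 6 *_) (sumMap-cong outLabels-weight (paths (suc u') n (+ 1))) ⟩
      + 6 * sumMap (weight (+ 0) α β γ) (paths (suc u') n (+ 1))
        ≡⟨ sumMap-weight-paths (suc u') (+ 0) α β γ a k n≡a+k
             (sym (trans (cong (_- A) UB≡1+A) (cancel A))) ⟩
      + pathCount a k * (+ 0 + labelMoment U A B α β γ)
        ≡⟨ cong₂ (λ n x → + (n C k) * x) (sym n≡a+k)
                 (trans (ℤ.+-identityˡ _) (labelMoment-critical U A B α β γ UB≡1+A)) ⟩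
      K * (A * (+ 6 * α + + 6 * β + γ * (A + + 7 + (+ 1 + A) * U)))
        ∎
      where
      cancel : ∀ A → (+ 1 + A) - A ≡ + 1
      cancel = solve-∀
      outLabels-weight : ∀ w → sumMap g (outLabels (minus1 ∷ w)) ≡ weight (+ 0) α β γ w
      outLabels-weight w = begin
        sumMap g (outLabels (minus1 ∷ w))              ≡⟨ cong (sumMap g) (outLabels≡map-labels minus1 w) ⟩
        sumMap g (map (λ x → minus1 + x) (labels w))   ≡⟨ sumMap-map g _ (labels w) ⟩
        sumMap (λ x → g (minus1 + x)) (labels w)       ≡⟨ sumMap-cong g≗q (labels w) ⟩
        sumMap (quad α β γ) (labels w)                 ≡⟨ ℤ.+-identityˡ _ ⟨
        weight (+ 0) α β γ w                           ∎

    coeff-tPt : + (m ∸ 1) * (+ k * coeffP (λ _ → + 1) m k) ≡ + gammaCoeff m k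
    coeff-tPt = begin
      U * (B * coeffP (λ _ → + 1) m k)  ≡⟨ cong (λ c → U * (B * c)) coeff≡ ⟩
      U * (B * (A * K))                 ≡⟨ reassoc U B A K ⟩
      U * B * A * K                     ≡⟨ cong (λ x → x * A * K) UB≡1+A ⟩
      (+ 1 + A) * A * K                 ≡⟨ pos-*³ (suc a) a (n C k) ⟨
      + gammaCoeff m k                  ∎
      where
      reassoc : ∀ U B A K → U * (B * (A * K)) ≡ U * B * A * K
      reassoc = solve-∀
      one : ∀ x → + 1 ≡ + 1 + + 0 * x + + 0 * (x * x)
      one = solve-∀
      evaluate : ∀ U A K →
        K * (A * (+ 6 * + 1 + + 6 * + 0 + + 0 * (A + + 7 + (+ 1 + A) * U))) ≡ + 6 * (A * K)
      evaluate = solve-∀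
      coeff≡ : coeffP (λ _ → + 1) m k ≡ A * K
      coeff≡ = ℤ.*-cancelˡ-≡ (+ 6) _ _
        (trans (coeffP-quad (λ _ → + 1) (+ 1) (+ 0) (+ 0) one) (evaluate U A K))

    coeff-PX : coeffP (λ x → x) m k ≡ + 0
    coeff-PX = ℤ.*-cancelˡ-≡ (+ 6) _ _
      (trans (coeffP-quad (λ x → x) minus1 (+ 1) (+ 0) id) (evaluate U A K))
      where
      id : ∀ x → minus1 + x ≡ minus1 + + 1 * x + + 0 * (x * x)
      id = solve-∀
      evaluate : ∀ U A K →
        K * (A * (+ 6 * minus1 + + 6 * + 1 + + 0 * (A + + 7 + (+ 1 + A) * U))) ≡ + 6 * + 0
      evaluate = solve-∀

    coeff-PXX : + 6 * coeffP (λ x → x * (x - + 1)) m k ≡ + m * + gammaCoeff m k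
    coeff-PXX = begin
      + 6 * coeffP (λ x → x * (x - + 1)) m k  ≡⟨ coeffP-quad _ (+ 2) -[1+ 2 ] (+ 1) falling ⟩
      K * (A * (+ 6 * + 2 + + 6 * -[1+ 2 ] + + 1 * (A + + 7 + (+ 1 + A) * U)))
                                              ≡⟨ evaluate U A K ⟩
      (+ 1 + U) * ((+ 1 + A) * A * K)         ≡⟨ cong (+ m *_) (pos-*³ (suc a) a (n C k)) ⟨
      + m * + gammaCoeff m k                  ∎
      where
      falling : ∀ x → (minus1 + x) * ((minus1 + x) - + 1) ≡ + 2 + -[1+ 2 ] * x + + 1 * (x * x)
      falling = solve-∀
      evaluate : ∀ U A K → K * (A * (+ 6 * + 2 + + 6 * -[1+ 2 ] + + 1 * (A + + 7 + (+ 1 + A) * U)))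
                           ≡ (+ 1 + U) * ((+ 1 + A) * A * K)
      evaluate = solve-∀

module _ {c ℓ : Level} (R : CommutativeRing c ℓ) where
  open CommutativeRing R
  open import Relation.Binary.PropositionalEquality using (cong)
  open import Algebra.Properties.Ring ring using (-‿involutive; -‿distribʳ-*; -0#≈0#)
  open import Relation.Binary.Reasoning.Setoid setoid

  natR-+ : ∀ a b → natR R (a ℕ.+ b) ≈ natR R a + natR R b
  natR-+ zero    b = sym (+-identityˡ _)
  natR-+ (suc a) b = trans (+-congˡ (natR-+ a b)) (sym (+-assoc _ _ _))

  natR-* : ∀ a b → natR R (a ℕ.* b) ≈ natR R a * natR R b
  natR-* zero    b = sym (zeroˡ _)
  natR-* (suc a) b = begin
    natR R (b ℕ.+ a ℕ.* b)             ≈⟨ natR-+ b (a ℕ.* b) ⟩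
    natR R b + natR R (a ℕ.* b)         ≈⟨ +-cong (sym (*-identityˡ _)) (natR-* a b) ⟩
    1# * natR R b + natR R a * natR R b ≈⟨ distribʳ _ _ _ ⟨
    (1# + natR R a) * natR R b          ∎

  intR-neg : ∀ x → intR R (Int.- x) ≈ - intR R x
  intR-neg (+ zero)  = sym -0#≈0#
  intR-neg (+ suc n) = refl
  intR-neg -[1+ n ]  = sym (-‿involutive _)

  intR-+* : ∀ a y → intR R (+ a Int.* y) ≈ natR R a * intR R y
  intR-+* a (+ b) = begin
    intR R (+ a Int.* + b)              ≡⟨ cong (intR R) (ℤ.pos-* a b) ⟨
    natR R (a ℕ.* b)                    ≈⟨ natR-* a b ⟩
    natR R a * natR R b                 ∎
  intR-+* a -[1+ b ] = begin
    intR R (+ a Int.* -[1+ b ])         ≡⟨ cong (intR R) (ℤ.neg-distribʳ-* (+ a) (+ suc b)) ⟨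
    intR R (Int.- (+ a Int.* + suc b))  ≈⟨ intR-neg (+ a Int.* + suc b) ⟩
    - intR R (+ a Int.* + suc b)        ≈⟨ -‿cong (intR-+* a (+ suc b)) ⟩
    - (natR R a * natR R (suc b))       ≈⟨ -‿distribʳ-* _ _ ⟩
    natR R a * - natR R (suc b)         ∎

  intR-+*-≡ : ∀ a x {y} → + a Int.* x ≡ y → natR R a * intR R x ≈ intR R y
  intR-+*-≡ a x ax≡y = trans (sym (intR-+* a x)) (reflexive (cong (intR R) ax≡y))

  seriesD-cong : ∀ {P : ℕ → Set} {D f g} t → All P D → (∀ {k} → P k → f k ≈ g k) →
                 seriesD R D f t ≈ seriesD R D g t
  seriesD-cong t []         f≈g = refl
  seriesD-cong t (pk ∷ pks) f≈g = +-cong (*-congʳ (f≈g pk)) (seriesD-cong t pks f≈g)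

  seriesD-*ˡ : ∀ D x f t → x * seriesD R D f t ≈ seriesD R D (λ k → x * f k) t
  seriesD-*ˡ []      x f t = zeroʳ x
  seriesD-*ˡ (k ∷ D) x f t =
    trans (distribˡ _ _ _) (+-cong (sym (*-assoc _ _ _)) (seriesD-*ˡ D x f t))

  seriesD-zero : ∀ D t → seriesD R D (λ _ → 0#) t ≈ 0#
  seriesD-zero []      t = refl
  seriesD-zero (k ∷ D) t = trans (+-cong (zeroˡ _) (seriesD-zero D t)) (+-identityˡ _)

lemma11 : {c ℓ : Level} (R : CommutativeRing c ℓ) →
    let open CommutativeRing R in
    (m : ℕ) → m ≥ 2 →
    (D : List ℕ) → Unique D → All (λ k → 1 ≤ k) D → D ≢ [] →
    (m ≡ 2 → D ≢ 1 ∷ []) →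
    (t : Carrier) → critPoly R m D t ≈ 1# →
    (natR R (m ∸ 1) * tPt R m D t ≈ gamma R m D t)
    × (PX R m D t ≈ 0#)
    × (natR R 6 * PXX R m D t ≈ natR R m * gamma R m D t)
lemma11 R (suc zero) (s≤s ()) D _ _ _ _ t _
lemma11 R (suc (suc u')) _ D _ D⁺ _ _ t _ = tPt≈γ , PX≈0 , PXX≈γ
  where
  open CommutativeRing R
  open import Relation.Binary.PropositionalEquality using (cong)
  open import Relation.Binary.Reasoning.Setoid setoid
  m = suc (suc u')

  tPt≈γ : natR R (m ∸ 1) * tPt R m D t ≈ gamma R m D t
  tPt≈γ = begin
    natR R (m ∸ 1) * tPt R m D t
      ≈⟨ seriesD-*ˡ R D _ _ t ⟩
    seriesD R D (λ k → natR R (m ∸ 1) * intR R (+ k Int.* coeffP (λ _ → + 1) m k)) t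
      ≈⟨ seriesD-cong R t D⁺ (λ { {suc k'} _ → intR-+*-≡ R (m ∸ 1) _ (coeff-tPt u' k') }) ⟩
    gamma R m D t
      ∎

  PX≈0 : PX R m D t ≈ 0#
  PX≈0 = begin
    PX R m D t
      ≈⟨ seriesD-cong R t D⁺ (λ { {suc k'} _ → reflexive (cong (intR R) (coeff-PX u' k')) }) ⟩
    seriesD R D (λ _ → 0#) t
      ≈⟨ seriesD-zero R D t ⟩
    0#
      ∎

  PXX≈γ : natR R 6 * PXX R m D t ≈ natR R m * gamma R m D t
  PXX≈γ = begin
    natR R 6 * PXX R m D t
      ≈⟨ seriesD-*ˡ R D _ _ t ⟩
    seriesD R D (λ k → natR R 6 * intR R (coeffP (λ x → x Int.* (x Int.- + 1)) m k)) t
      ≈⟨ seriesD-cong R t D⁺ (λ { {suc k'} _ →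
           trans (intR-+*-≡ R 6 _ (coeff-PXX u' k')) (intR-+* R m (+ gammaCoeff m (suc k'))) }) ⟩
    seriesD R D (λ k → natR R m * natR R (gammaCoeff m k)) t
      ≈⟨ seriesD-*ˡ R D _ _ t ⟨
    natR R m * gamma R m D t
      ∎
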